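{- Let $(M,\mathrm{acc},\mathrm{rej})$ be a monitoring system that is maximal for the collection of all properties. Then a property $P\subseteq\mathrm{Act}^\infty$ has a monitor in $M$ that is sound and violation-complete for it if and only if $P$ is a safety property; and $P$ has a monitor in $M$ that is sound and satisfaction-complete for it if and only if $P$ is a co-safety property.
   Context: $\mathrm{Act}$ is a finite set of actions, $\mathrm{Act}^\infty=\mathrm{Act}^*\cup\mathrm{Act}^\omega$; a property is a subset of $\mathrm{Act}^\infty$. A finite trace $s$ positively (resp. negatively) determines $P$ if $sf\in P$ (resp. $sf\notin P$) for all $f\in\mathrm{Act}^\infty$. $P$ is a safety property if every $f\notin P$ has a finite prefix that negatively determines $P$, and a co-safety property if every $f\in P$ has a finite prefix that positively determines $P$. A monitoring system is a triple $(M,\mathrm{acc},\mathrm{rej})$ with $M$ nonempty, $\mathrm{acc},\mathrm{rej}\subseteq M\times\mathrm{Act}^\infty$, such that for every $m$: (1) $\mathrm{acc}(m,f)$ implies $\mathrm{acc}(m,s)$ for some finite prefix $s$ of $f$, likewise for $\mathrm{rej}$; (2) $\mathrm{acc}(m,s)$ for finite $s$ implies $\mathrm{acc}(m,sf)$ for all $f$, likewise for $\mathrm{rej}$. It is maximal for a collection $C$ if for every $P\in C$ there is $m_P\in M$ with $\mathrm{acc}(m_P,f)$ iff $f$ has a finite prefix positively determining $P$, and $\mathrm{rej}(m_P,f)$ iff $f$ has a finite prefix negatively determining $P$. $m$ is sound for $P$ if $\mathrm{acc}(m,f)\Rightarrow f\in P$ and $\mathrm{rej}(m,f)\Rightarrow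 f\notin P$; satisfaction-complete if $f\in P\Rightarrow\mathrm{acc}(m,f)$; violation-complete if $f\notin P\Rightarrow\mathrm{rej}(m,f)$. -}

module Defs where

open import Data.Nat using (ℕ; zero; suc)
open import Data.Fin using (Fin)
open import Data.List using (List; []; _∷_; _++_; length)
open import Data.Sum using (_⊎_; inj₁; inj₂)
open import Data.Product using (Σ; ∃; _×_; _,_)
open import Relation.Binary.PropositionalEquality using (_≡_)
open import Relation.Nullary using (¬_)
open import Function.Bundles using (_↔_)

IsFinite : Set → Set
IsFinite A = ∃ λ n → A ↔ Fin n

-- Act^∞ = Act^* ∪ Act^ω : a trace is either a finite list or an infinite stream.
Trace : Set → Set
Trace Act = List Act ⊎ (ℕ → Act)

fin : {Act : Set} → List Act → Trace Act
fin s = inj₁ s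

takeω : {Act : Set} → ℕ → (ℕ → Act) → List Act
takeω zero    f = []
takeω (suc n) f = f 0 ∷ takeω n (λ i → f (suc i))

-- s is a finite prefix of the trace f (i.e. f = s g for some g ∈ Act^∞)
_≼_ : {Act : Set} → List Act → Trace Act → Set
s ≼ inj₁ t = ∃ λ u → s ++ u ≡ t
s ≼ inj₂ f = takeω (length s) f ≡ s

Property : Set → Set₁
Property Act = Trace Act → Set

-- s positively determines P : s f ∈ P for every f ∈ Act^∞
-- (the traces of the form s f are exactly the traces having s as prefix)
PosDet : {Act : Set} → Property Act → List Act → Set
PosDet P s = ∀ g → s ≼ g → P g

NegDet : {Act : Set} → Property Act → List Act → Set
NegDet P s = ∀ g → s ≼ g → ¬ P g

IsSafety : {Act : Set} → Property Act → Set
IsSafety P = ∀ f → ¬ P f → ∃ λ s → s ≼ f × NegDet P s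

IsCoSafety : {Act : Set} → Property Act → Set
IsCoSafety P = ∀ f → P f → ∃ λ s → s ≼ f × PosDet P s

record MonitoringSystem (Act : Set) : Set₁ where
  field
    M        : Set
    m₀       : M        -- M is nonempty
    acc      : M → Trace Act → Set
    rej      : M → Trace Act → Set
    acc-fin  : ∀ m f → acc m f → ∃ λ s → s ≼ f × acc m (fin s)
    rej-fin  : ∀ m f → rej m f → ∃ λ s → s ≼ f × rej m (fin s)
    acc-ext  : ∀ m s → acc m (fin s) → ∀ g → s ≼ g → acc m g
    rej-ext  : ∀ m s → rej m (fin s) → ∀ g → s ≼ g → rej m g

module _ {Act : Set} (S : MonitoringSystem Act) where
  open MonitoringSystem S

  IsMaximalForAll : Set₁
  IsMaximalForAll = ∀ (P : Property Act) → Σ M λ mP →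
      (∀ f → acc mP f → ∃ λ s → s ≼ f × PosDet P s)
    × (∀ f → (∃ λ s → s ≼ f × PosDet P s) → acc mP f)
    × (∀ f → rej mP f → ∃ λ s → s ≼ f × NegDet P s)
    × (∀ f → (∃ λ s → s ≼ f × NegDet P s) → rej mP f)

  Sound : M → Property Act → Set
  Sound m P = (∀ f → acc m f → P f) × (∀ f → rej m f → ¬ P f)

  SatComplete : M → Property Act → Set
  SatComplete m P = ∀ f → P f → acc m f

  VioComplete : M → Property Act → Set
  VioComplete m P = ∀ f → ¬ P f → rej m f

-- A sound, violation-complete monitor rejects every violating trace, and by the finiteness
-- axiom already on a finite prefix; by the extension axiom it then rejects every extension of
-- that prefix, so soundness makes the prefix negatively determine P. Conversely, the monitor
-- provided by maximality rejects exactly the traces with a negatively determining prefix,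
-- which for a safety property are all violating traces. Satisfaction is dual.
module Submission where

open import Defs
open import Data.Product using (Σ; ∃; _×_; _,_; proj₁; proj₂)
open import Function.Bundles using (_⇔_; mk⇔)
open import Relation.Nullary using (¬_)

module _ {Act : Set} (S : MonitoringSystem Act) where
  open MonitoringSystem S

  rejectionSound∧vioComplete⇒safety : ∀ {m P} → (∀ f → rej m f → ¬ P f) →
    VioComplete S m P → IsSafety P
  rejectionSound∧vioComplete⇒safety {m} rej⇒¬P vc f ¬Pf =
    let (s , s≼f , rej-s) = rej-fin m f (vc f ¬Pf)
    in s , s≼f , λ g s≼g → rej⇒¬P g (rej-ext m s rej-s g s≼g)

  acceptanceSound∧satComplete⇒coSafety : ∀ {m P} → (∀ f → acc m f → P f) →
    SatComplete S m P → IsCoSafety P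
  acceptanceSound∧satComplete⇒coSafety {m} acc⇒P sc f Pf =
    let (s , s≼f , acc-s) = acc-fin m f (sc f Pf)
    in s , s≼f , λ g s≼g → acc⇒P g (acc-ext m s acc-s g s≼g)

  module _ (maximal : IsMaximalForAll S) (P : Property Act) where

    maximalMonitor : M
    maximalMonitor = proj₁ (maximal P)

    private
      acc⇒posDet : ∀ f → acc maximalMonitor f → ∃ λ s → s ≼ f × PosDet P s
      acc⇒posDet = proj₁ (proj₂ (maximal P))

      posDet⇒acc : ∀ f → (∃ λ s → s ≼ f × PosDet P s) → acc maximalMonitor f
      posDet⇒acc = proj₁ (proj₂ (proj₂ (maximal P)))

      rej⇒negDet : ∀ f → rej maximalMonitor f → ∃ λ s → s ≼ f × NegDet P s
      rej⇒negDet = proj₁ (proj₂ (proj₂ (proj₂ (maximal P))))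

      negDet⇒rej : ∀ f → (∃ λ s → s ≼ f × NegDet P s) → rej maximalMonitor f
      negDet⇒rej = proj₂ (proj₂ (proj₂ (proj₂ (maximal P))))

    maximalMonitor-sound : Sound S maximalMonitor P
    maximalMonitor-sound =
        (λ f acc-f → let (s , s≼f , pos) = acc⇒posDet f acc-f in pos f s≼f)
      , (λ f rej-f → let (s , s≼f , neg) = rej⇒negDet f rej-f in neg f s≼f)

    safety⇒maximalMonitor-vioComplete : IsSafety P → VioComplete S maximalMonitor P
    safety⇒maximalMonitor-vioComplete safe f ¬Pf = negDet⇒rej f (safe f ¬Pf)

    coSafety⇒maximalMonitor-satComplete : IsCoSafety P → SatComplete S maximalMonitor P
    coSafety⇒maximalMonitor-satComplete cosafe f Pf = posDet⇒acc f (cosafe f Pf)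

theorem6 : {Act : Set} → IsFinite Act → (S : MonitoringSystem Act) → IsMaximalForAll S →
    (P : Property Act) →
      ((Σ (MonitoringSystem.M S) λ m → Sound S m P × VioComplete S m P) ⇔ IsSafety P)
    × ((Σ (MonitoringSystem.M S) λ m → Sound S m P × SatComplete S m P) ⇔ IsCoSafety P)
theorem6 _ S maximal P =
    mk⇔ (λ (_ , (_ , rej⇒¬P) , vc) → rejectionSound∧vioComplete⇒safety S rej⇒¬P vc)
        (λ safe → maximalMonitor S maximal P , maximalMonitor-sound S maximal P
                , safety⇒maximalMonitor-vioComplete S maximal P safe)
  , mk⇔ (λ (_ , (acc⇒P , _) , sc) → acceptanceSound∧satComplete⇒coSafety S acc⇒P sc)
        (λ cosafe → maximalMonitor S maximal P , maximalMonitor-sound S maximal P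
                  , coSafety⇒maximalMonitor-satComplete S maximal P cosafe)
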